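{- Let $C$ be a $d$-dimensional cube and let $\Gamma$ be a cubical subdivision of $C$ with subdivision map $\sigma$. For a nonempty face $F$ of $\Gamma$ let $e(F)=\dim\sigma(F)-\dim(F)$ (the excess of $F$). Then $$\ell_C(\Gamma,x)\;=\;(-1)^d\sum_{F\in\Gamma\setminus\{\varnothing\}}(-2)^{\dim(F)}\,x^{d-e(F)}(x-1)^{e(F)}.$$
   Context: A $d$-dimensional (abstract) cube is a poset isomorphic to the poset of all faces (including the empty face) of $[0,1]^d$, ordered by inclusion. A cubical complex is a finite poset $K$ with a minimum element $\varnothing$ (the empty face) such that every interval $[\varnothing,F]$ is a cube and any two elements of $K$ have a greatest lower bound. Elements are called faces; $\dim F$ is the dimension of the cube $[\varnothing,F]$ (so $\dim\varnothing=-1$), vertices are $0$-dimensional faces, and $\dim K$ is the maximum dimension of a face. $\mathcal F(K)$ denotes the set of nonempty faces; a subcomplex is a nonempty order ideal. Topological properties of $K$ refer to the order complex of $\mathcal F(K)$. A face $F$ of a cubical complex is itself regarded as the cubical complex $[\varnothing,F]$; in particular a cube $C$ is a cubical complex. A cubical subdivision of a cubical complex $K$ is a cubical complex $K'$ together with a map $\sigma:\mathcal F(K')\to\mathcal F(K)$ such that for every $F\in\mathcal F(K)$: (a) $K'_F:=\sigma^{ -1}(\{G\in\mathcal F(K):G\le F\})\cup\{\varnothing\}$ is a subcomplex of $K'$ homeomorphic to a ball of dimension $\dim F$; (b) $\sigma^{ -1}(F)$ is the set of interior faces of this ball (the faces not in its boundary). $K'_F$ (the restriction of $K'$ to $F$)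 is regarded as a cubical subdivision of the cube $F$, and $\sigma(G)$ is called the carrier of $G$. For a cubical complex $K$ of dimension $d$, its short cubical $h$-polynomial is $h^{(sc)}(K,x)=\sum_{F\in K\setminus\{\varnothing\}}(2x)^{\dim F}(1-x)^{d-\dim F}$. For a cubical subdivision $\Gamma$ of a $d$-dimensional cube $C$, the short cubical local $h$-polynomial is $\ell_C(\Gamma,x)=\sum_{F\in\mathcal F(C)}(-1)^{d-\dim F}h^{(sc)}(\Gamma_F,x)$, where $h^{(sc)}(\Gamma_F,x)$ is computed with $\Gamma_F$ of dimension $\dim F$. -}

module Defs where

open import Data.Nat as ℕ using (ℕ; zero; suc; _∸_)
open import Data.Integer as ℤ using (ℤ; +_; _+_; _*_; -_; _-_; _^_)
open import Data.Fin using (Fin)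
open import Data.Vec using (Vec; []; _∷_)
open import Data.List as L using (List; concatMap; allFin; filter; foldr)
open import Data.Product using (Σ; _×_; proj₁)
open import Data.Sum using (_⊎_)
open import Function.Bundles using (_⇔_)
open import Relation.Nullary using (¬_; Dec; yes; no)
open import Relation.Binary.PropositionalEquality using (_≡_; refl)
open import Relation.Binary.Structures using (IsPartialOrder)
open import Data.Vec.Relation.Binary.Pointwise.Inductive as PW using (Pointwise)

-- The standard cube [0,1]^k : its nonempty faces are words in {0,1,*}^k

data Tri : Set where
  𝟎 𝟏 ⋆ : Tri

data _⊑_ : Tri → Tri → Set where
  ⊑-refl : ∀ {a} → a ⊑ a
  ⊑-⋆    : ∀ {a} → a ⊑ ⋆

_⊑?_ : ∀ a b → Dec (a ⊑ b)
𝟎 ⊑? 𝟎 = yes ⊑-refl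
𝟎 ⊑? 𝟏 = no λ ()
𝟎 ⊑? ⋆ = yes ⊑-⋆
𝟏 ⊑? 𝟎 = no λ ()
𝟏 ⊑? 𝟏 = yes ⊑-refl
𝟏 ⊑? ⋆ = yes ⊑-⋆
⋆ ⊑? 𝟎 = no λ ()
⋆ ⊑? 𝟏 = no λ ()
⋆ ⊑? ⋆ = yes ⊑-refl

CubeFace : ℕ → Set
CubeFace k = Vec Tri k

_≤ᶜ_ : ∀ {k} → CubeFace k → CubeFace k → Set
_≤ᶜ_ = Pointwise _⊑_

_≤ᶜ?_ : ∀ {k} (u v : CubeFace k) → Dec (u ≤ᶜ v)
_≤ᶜ?_ = PW.decidable _⊑?_

cdim : ∀ {k} → CubeFace k → ℕ
cdim [] = 0
cdim (𝟎 ∷ v) = cdim v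
cdim (𝟏 ∷ v) = cdim v
cdim (⋆ ∷ v) = suc (cdim v)

allCubeFaces : ∀ k → List (CubeFace k)
allCubeFaces zero = [] L.∷ L.[]
allCubeFaces (suc k) =
  concatMap (λ v → (𝟎 ∷ v) L.∷ (𝟏 ∷ v) L.∷ (⋆ ∷ v) L.∷ L.[]) (allCubeFaces k)

-- Cubical complexes.  Nonempty faces are Fin size; the empty face is the
-- implicit minimum (it lies below everything), so it is not listed.

record CubicalComplex : Set₁ where
  field
    size   : ℕ
    _≤_    : Fin size → Fin size → Set
    isPartialOrder : IsPartialOrder _≡_ _≤_
    dim    : Fin size → ℕ
    -- every interval [∅,F] is a cube of dimension dim F: an order
    -- isomorphism between the nonempty faces below F and the nonempty
    -- faces of the (dim F)-cube (the empty faces correspond to each other)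
    toCube   : ∀ F → Σ (Fin size) (λ G → G ≤ F) → CubeFace (dim F)
    fromCube : ∀ F → CubeFace (dim F) → Σ (Fin size) (λ G → G ≤ F)
    from∘to  : ∀ F p → proj₁ (fromCube F (toCube F p)) ≡ proj₁ p
    to∘from  : ∀ F c → toCube F (fromCube F c) ≡ c
    toCube-order : ∀ F p q → (proj₁ p ≤ proj₁ q) ⇔ (toCube F p ≤ᶜ toCube F q)
    -- any two faces have a greatest lower bound (the empty face if they
    -- have no common nonempty lower bound)
    glb : ∀ F G →
      (∀ H → ¬ (H ≤ F × H ≤ G)) ⊎
      Σ (Fin size) (λ M → M ≤ F × M ≤ G × (∀ H → H ≤ F → H ≤ G → H ≤ M))

open CubicalComplex public

-- The topological notion "the subcomplex S is homeomorphic to a k-ball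
-- whose interior faces are exactly Int" is not expressible without
-- topology; it is taken as an arbitrary parameter `Ball`.

BallPredicate : Set₁
BallPredicate =
  (K : CubicalComplex) → (Fin (size K) → Set) → ℕ → (Fin (size K) → Set) → Set

record CubicalSubdivision (Ball : BallPredicate) (d : ℕ) (Γ : CubicalComplex) : Set where
  field
    σ : Fin (size Γ) → CubeFace d
    -- (a) Γ_F = σ⁻¹(≤F) ∪ {∅} is a subcomplex (order ideal) ...
    restriction-ideal : ∀ F G H → _≤_ Γ G H → σ H ≤ᶜ F → σ G ≤ᶜ F
    -- ... homeomorphic to a (dim F)-ball, and (b) whose interior faces are σ⁻¹(F)
    restriction-ball : ∀ F → Ball Γ (λ G → σ G ≤ᶜ F) (cdim F) (λ G → σ G ≡ F)
    -- consequence of (a): Γ_F has dimension dim F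
    dim-carrier : ∀ G → dim Γ G ℕ.≤ cdim (σ G)

open CubicalSubdivision public

-- Polynomials are represented by their evaluation at integers x.

sumℤ : List ℤ → ℤ
sumℤ = foldr _+_ (+ 0)

hscFromDims : ℕ → List ℕ → ℤ → ℤ
hscFromDims n ds x = sumℤ (L.map (λ k → ((+ 2 * x) ^ k) * ((+ 1 - x) ^ (n ∸ k))) ds)

hscRestriction : ∀ {Ball d Γ} → CubicalSubdivision Ball d Γ → CubeFace d → ℤ → ℤ
hscRestriction {Γ = Γ} S F x =
  hscFromDims (cdim F)
    (L.map (dim Γ) (filter (λ G → σ S G ≤ᶜ? F) (allFin (size Γ)))) x

localH : ∀ {Ball d Γ} → CubicalSubdivision Ball d Γ → ℤ → ℤ
localH {d = d} S x =
  sumℤ (L.map (λ F → ((- + 1) ^ (d ∸ cdim F)) * hscRestriction S F x) (allCubeFaces d))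

excess : ∀ {Ball d Γ} → CubicalSubdivision Ball d Γ → Fin (size Γ) → ℕ
excess {Γ = Γ} S G = cdim (σ S G) ∸ dim Γ G

-- Expanding ℓ_C(Γ,x) and exchanging the two sums, each face G of Γ with
-- carrier v = σ(G) contributes (2x)^{dim G} times a sum over the faces F of C
-- containing v.  Writing y = 1 - x, that inner sum factors over the d
-- coordinates of the cube: a free coordinate of v contributes 1, a fixed one
-- contributes y - 1 = -x (F either keeps it fixed, costing a sign, or frees
-- it, costing a factor y); hence
--   Σ_{F ⊇ v} (-1)^{d - dim F} y^{dim F - dim v} = (y - 1)^{d - dim v},
-- and the contribution of G is the monomial
--   (2x)^{dim G} (1-x)^{e(G)} (-x)^{d - dim v} = (-1)^d (-2)^{dim G} x^{d-e(G)} (x-1)^{e(G)}.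
module Submission where

open import Defs
open import Data.Nat using (ℕ; _∸_)
open import Data.Integer using (ℤ; +_; _+_; _*_; -_; _-_; _^_)
open import Data.List using (map; allFin)
open import Relation.Binary.PropositionalEquality using (_≡_)

open import Data.Bool using (true; false; if_then_else_)
open import Data.Bool.Properties using (if-float; if-cong-else)
open import Data.Integer.Properties as ℤ using ()
open import Data.Integer.Tactic.RingSolver using (solve-∀)
open import Data.List as List using (List; []; _∷_; _++_; concatMap; filter)
open import Data.List.Properties as List using ()
open import Data.Nat as ℕ using (zero; suc; z≤n; s≤s)
open import Data.Nat.Properties as ℕ using ()
open import Data.Fin using (Fin)
open import Data.Vec using ([]; _∷_)
open import Data.Vec.Relation.Binary.Pointwise.Inductive as Pointwise using ()
open import Relation.Nullary using (Dec; yes; no; does)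
open import Relation.Binary.PropositionalEquality
  using (refl; sym; trans; cong; cong₂; module ≡-Reasoning)
open ≡-Reasoning

private
  variable
    A B : Set

sumℤ-++ : ∀ (xs ys : List ℤ) → sumℤ (xs ++ ys) ≡ sumℤ xs + sumℤ ys
sumℤ-++ []       ys = sym (ℤ.+-identityˡ (sumℤ ys))
sumℤ-++ (x ∷ xs) ys = trans (cong (_+_ x) (sumℤ-++ xs ys)) (sym (ℤ.+-assoc x (sumℤ xs) (sumℤ ys)))

sumℤ-cong : {f g : A → ℤ} → (∀ a → f a ≡ g a) → ∀ xs → sumℤ (map f xs) ≡ sumℤ (map g xs)
sumℤ-cong f≗g xs = cong sumℤ (List.map-cong f≗g xs)

sumℤ-concatMap : ∀ (f : B → ℤ) (g : A → List B) xs →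
  sumℤ (map f (concatMap g xs)) ≡ sumℤ (map (λ a → sumℤ (map f (g a))) xs)
sumℤ-concatMap f g []       = refl
sumℤ-concatMap f g (x ∷ xs) = begin
  sumℤ (map f (g x ++ concatMap g xs))               ≡⟨ cong sumℤ (List.map-++ f (g x) _) ⟩
  sumℤ (map f (g x) ++ map f (concatMap g xs))       ≡⟨ sumℤ-++ (map f (g x)) _ ⟩
  sumℤ (map f (g x)) + sumℤ (map f (concatMap g xs)) ≡⟨ cong (_+_ (sumℤ (map f (g x)))) (sumℤ-concatMap f g xs) ⟩
  sumℤ (map f (g x)) + sumℤ (map (λ a → sumℤ (map f (g a))) xs) ∎

sumℤ-zero : ∀ (xs : List A) → sumℤ (map (λ _ → + 0) xs) ≡ + 0
sumℤ-zero []       = refl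
sumℤ-zero (_ ∷ xs) = trans (ℤ.+-identityˡ _) (sumℤ-zero xs)

sumℤ-*ˡ : ∀ c (f : A → ℤ) xs → c * sumℤ (map f xs) ≡ sumℤ (map (λ a → c * f a) xs)
sumℤ-*ˡ c f []       = ℤ.*-zeroʳ c
sumℤ-*ˡ c f (x ∷ xs) = trans (ℤ.*-distribˡ-+ c (f x) _) (cong (_+_ (c * f x)) (sumℤ-*ˡ c f xs))

sumℤ-+ : ∀ (f g : A → ℤ) xs →
  sumℤ (map (λ a → f a + g a) xs) ≡ sumℤ (map f xs) + sumℤ (map g xs)
sumℤ-+ f g []       = refl
sumℤ-+ f g (x ∷ xs) = begin
  f x + g x + sumℤ (map (λ a → f a + g a) xs)     ≡⟨ cong (_+_ (f x + g x)) (sumℤ-+ f g xs) ⟩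
  f x + g x + (sumℤ (map f xs) + sumℤ (map g xs)) ≡⟨ medial (f x) (g x) _ _ ⟩
  f x + sumℤ (map f xs) + (g x + sumℤ (map g xs)) ∎
  where
  medial : ∀ a b c d → a + b + (c + d) ≡ a + c + (b + d)
  medial = solve-∀

sumℤ-comm : ∀ (h : A → B → ℤ) xs ys →
  sumℤ (map (λ a → sumℤ (map (h a) ys)) xs) ≡ sumℤ (map (λ b → sumℤ (map (λ a → h a b) xs)) ys)
sumℤ-comm h []       ys = sym (sumℤ-zero ys)
sumℤ-comm h (x ∷ xs) ys = trans (cong (_+_ (sumℤ (map (h x) ys))) (sumℤ-comm h xs ys))
                                (sym (sumℤ-+ (h x) (λ b → sumℤ (map (λ a → h a b) xs)) ys))

sumℤ-filter : ∀ {P : A → Set} (P? : ∀ a → Dec (P a)) (f : A → ℤ) xs →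
  sumℤ (map f (filter P? xs)) ≡ sumℤ (map (λ a → if does (P? a) then f a else + 0) xs)
sumℤ-filter P? f []       = refl
sumℤ-filter P? f (x ∷ xs) with does (P? x)
... | true  = cong (_+_ (f x)) (sumℤ-filter P? f xs)
... | false = trans (sumℤ-filter P? f xs) (sym (ℤ.+-identityˡ _))

*-if-zero : ∀ c b z → c * (if b then z else + 0) ≡ (if b then c * z else + 0)
*-if-zero c b z = trans (if-float (c *_) b) (if-cong-else b (ℤ.*-zeroʳ c))

^-distribʳ-* : ∀ i j n → (i * j) ^ n ≡ i ^ n * j ^ n
^-distribʳ-* i j zero    = refl
^-distribʳ-* i j (suc n) = trans (cong ((i * j) *_) (^-distribʳ-* i j n)) (interchange i j _ _)
  where
  interchange : ∀ a b c d → a * b * (c * d) ≡ a * c * (b * d)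
  interchange = solve-∀

^-factor : ∀ {i j k} → i ≡ j * k → ∀ n → i ^ n ≡ j ^ n * k ^ n
^-factor {j = j} {k} refl n = ^-distribʳ-* j k n

monomial-identity : ∀ x a e g →
  (+ 2 * x) ^ g * (+ 1 - x) ^ e * ((+ 1 - x) - + 1) ^ a
    ≡ (- + 1) ^ (a ℕ.+ g ℕ.+ e) * ((- + 2) ^ g * (x ^ (a ℕ.+ g) * (x - + 1) ^ e))
monomial-identity x a e g = begin
  (+ 2 * x) ^ g * (+ 1 - x) ^ e * ((+ 1 - x) - + 1) ^ a
    ≡⟨ cong₂ _*_ (cong₂ _*_ twoX (^-factor (eq₁ x) e)) (^-factor (eq₀ x) a) ⟩
  m ^ g * ((- + 2) ^ g * x ^ g) * (m ^ e * (x - + 1) ^ e) * (m ^ a * x ^ a)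
    ≡⟨ regroup (m ^ g) (m ^ e) (m ^ a) ((- + 2) ^ g) (x ^ g) (x ^ a) ((x - + 1) ^ e) ⟩
  m ^ a * m ^ g * m ^ e * ((- + 2) ^ g * (x ^ a * x ^ g * (x - + 1) ^ e))
    ≡⟨ cong₂ (λ s t → s * ((- + 2) ^ g * (t * (x - + 1) ^ e))) signs (sym (ℤ.^-distribˡ-+-* x a g)) ⟩
  m ^ (a ℕ.+ g ℕ.+ e) * ((- + 2) ^ g * (x ^ (a ℕ.+ g) * (x - + 1) ^ e)) ∎
  where
  m = - + 1
  eq₂ : ∀ x → + 2 * x ≡ m * (- + 2 * x)
  eq₂ = solve-∀
  eq₁ : ∀ x → + 1 - x ≡ m * (x - + 1)
  eq₁ = solve-∀
  eq₀ : ∀ x → (+ 1 - x) - + 1 ≡ m * x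
  eq₀ = solve-∀
  twoX : (+ 2 * x) ^ g ≡ m ^ g * ((- + 2) ^ g * x ^ g)
  twoX = trans (^-factor (eq₂ x) g) (cong (m ^ g *_) (^-distribʳ-* (- + 2) x g))
  signs : m ^ a * m ^ g * m ^ e ≡ m ^ (a ℕ.+ g ℕ.+ e)
  signs = sym (trans (ℤ.^-distribˡ-+-* m (a ℕ.+ g) e)
                     (cong (_* m ^ e) (ℤ.^-distribˡ-+-* m a g)))
  regroup : ∀ sg se sa t u v w → sg * (t * u) * (se * w) * (sa * v) ≡ sa * sg * se * (t * (v * u * w))
  regroup = solve-∀

∸-split : ∀ {g s f} → g ℕ.≤ s → s ℕ.≤ f → f ∸ g ≡ (s ∸ g) ℕ.+ (f ∸ s)
∸-split {zero}           z≤n      s≤f       = sym (ℕ.m+[n∸m]≡n s≤f)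
∸-split {suc g} {suc s} {suc f} (s≤s g≤s) (s≤s s≤f) = ∸-split g≤s s≤f

∸-partition : ∀ {g s d} → g ℕ.≤ s → s ℕ.≤ d → (d ∸ s) ℕ.+ g ℕ.+ (s ∸ g) ≡ d
∸-partition {g} {s} {d} g≤s s≤d = begin
  (d ∸ s) ℕ.+ g ℕ.+ (s ∸ g)   ≡⟨ ℕ.+-assoc (d ∸ s) g (s ∸ g) ⟩
  (d ∸ s) ℕ.+ (g ℕ.+ (s ∸ g)) ≡⟨ cong ((d ∸ s) ℕ.+_) (ℕ.m+[n∸m]≡n g≤s) ⟩
  (d ∸ s) ℕ.+ s               ≡⟨ ℕ.m∸n+n≡m s≤d ⟩
  d ∎

∸-partition-∸ : ∀ {g s d} → g ℕ.≤ s → s ℕ.≤ d → d ∸ (s ∸ g) ≡ (d ∸ s) ℕ.+ g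
∸-partition-∸ {g} {s} {d} g≤s s≤d = begin
  d ∸ (s ∸ g)                         ≡⟨ cong (_∸ (s ∸ g)) (sym (∸-partition g≤s s≤d)) ⟩
  (d ∸ s) ℕ.+ g ℕ.+ (s ∸ g) ∸ (s ∸ g) ≡⟨ ℕ.m+n∸n≡m ((d ∸ s) ℕ.+ g) (s ∸ g) ⟩
  (d ∸ s) ℕ.+ g ∎

cdim≤dim : ∀ {k} (w : CubeFace k) → cdim w ℕ.≤ k
cdim≤dim []      = z≤n
cdim≤dim (𝟎 ∷ w) = ℕ.m≤n⇒m≤1+n (cdim≤dim w)
cdim≤dim (𝟏 ∷ w) = ℕ.m≤n⇒m≤1+n (cdim≤dim w)
cdim≤dim (⋆ ∷ w) = s≤s (cdim≤dim w)

cdim-mono : ∀ {k} {v w : CubeFace k} → v ≤ᶜ w → cdim v ℕ.≤ cdim w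
cdim-mono Pointwise.[]                       = z≤n
cdim-mono (Pointwise._∷_ {x = 𝟎} ⊑-refl v≤w) = cdim-mono v≤w
cdim-mono (Pointwise._∷_ {x = 𝟏} ⊑-refl v≤w) = cdim-mono v≤w
cdim-mono (Pointwise._∷_ {x = ⋆} ⊑-refl v≤w) = s≤s (cdim-mono v≤w)
cdim-mono (Pointwise._∷_ {x = 𝟎} ⊑-⋆ v≤w)    = ℕ.m≤n⇒m≤1+n (cdim-mono v≤w)
cdim-mono (Pointwise._∷_ {x = 𝟏} ⊑-⋆ v≤w)    = ℕ.m≤n⇒m≤1+n (cdim-mono v≤w)
cdim-mono (Pointwise._∷_ {x = ⋆} ⊑-⋆ v≤w)    = s≤s (cdim-mono v≤w)

starTerm : ℤ → ∀ {d} → CubeFace d → CubeFace d → ℤ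
starTerm y {d} v F =
  if does (v ≤ᶜ? F) then (- + 1) ^ (d ∸ cdim F) * y ^ (cdim F ∸ cdim v) else + 0

coordinateFactor : ℤ → Tri → ℤ
coordinateFactor y 𝟎 = y - + 1
coordinateFactor y 𝟏 = y - + 1
coordinateFactor y ⋆ = + 1

fixedCoordinate-sum : ∀ y {k cw cv} → cw ℕ.≤ k → cv ℕ.≤ cw →
  (- + 1) ^ (suc k ∸ cw) * y ^ (cw ∸ cv) + (- + 1) ^ (k ∸ cw) * y ^ (suc cw ∸ cv)
    ≡ (y - + 1) * ((- + 1) ^ (k ∸ cw) * y ^ (cw ∸ cv))
fixedCoordinate-sum y {k} {cw} {cv} cw≤k cv≤cw
  rewrite ℕ.+-∸-assoc 1 cw≤k | ℕ.+-∸-assoc 1 cv≤cw = expand y ((- + 1) ^ (k ∸ cw)) (y ^ (cw ∸ cv))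
  where
  expand : ∀ y s t → (- + 1) * s * t + s * (y * t) ≡ (y - + 1) * (s * t)
  expand = solve-∀

starTerm-children : ∀ y {k} a (v w : CubeFace k) →
  sumℤ (map (starTerm y (a ∷ v)) ((𝟎 ∷ w) ∷ (𝟏 ∷ w) ∷ (⋆ ∷ w) ∷ []))
    ≡ coordinateFactor y a * starTerm y v w
starTerm-children y ⋆ v w = identities (starTerm y v w)
  where
  identities : ∀ t → + 0 + (+ 0 + (t + + 0)) ≡ + 1 * t
  identities = solve-∀
starTerm-children y {k} 𝟎 v w with v ≤ᶜ? w
... | no _    = sym (ℤ.*-zeroʳ (y - + 1))
... | yes v≤w = trans (shape fixedF freeF) (fixedCoordinate-sum y (cdim≤dim w) (cdim-mono v≤w))
  where
  fixedF = (- + 1) ^ (suc k ∸ cdim w) * y ^ (cdim w ∸ cdim v)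
  freeF  = (- + 1) ^ (k ∸ cdim w) * y ^ (suc (cdim w) ∸ cdim v)
  shape : ∀ a b → a + (+ 0 + (b + + 0)) ≡ a + b
  shape = solve-∀
starTerm-children y {k} 𝟏 v w with v ≤ᶜ? w
... | no _    = sym (ℤ.*-zeroʳ (y - + 1))
... | yes v≤w = trans (shape fixedF freeF) (fixedCoordinate-sum y (cdim≤dim w) (cdim-mono v≤w))
  where
  fixedF = (- + 1) ^ (suc k ∸ cdim w) * y ^ (cdim w ∸ cdim v)
  freeF  = (- + 1) ^ (k ∸ cdim w) * y ^ (suc (cdim w) ∸ cdim v)
  shape : ∀ a b → + 0 + (a + (b + + 0)) ≡ a + b
  shape = solve-∀

coordinateFactor-^ : ∀ y {k} a (v : CubeFace k) →
  coordinateFactor y a * (y - + 1) ^ (k ∸ cdim v) ≡ (y - + 1) ^ (suc k ∸ cdim (a ∷ v))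
coordinateFactor-^ y 𝟎 v = cong ((y - + 1) ^_) (sym (ℕ.+-∸-assoc 1 (cdim≤dim v)))
coordinateFactor-^ y 𝟏 v = cong ((y - + 1) ^_) (sym (ℕ.+-∸-assoc 1 (cdim≤dim v)))
coordinateFactor-^ y ⋆ v = ℤ.*-identityˡ _

sum-starTerm : ∀ y d (v : CubeFace d) →
  sumℤ (map (starTerm y v) (allCubeFaces d)) ≡ (y - + 1) ^ (d ∸ cdim v)
sum-starTerm y zero    []      = refl
sum-starTerm y (suc k) (a ∷ v) = begin
  sumℤ (map (starTerm y (a ∷ v)) (allCubeFaces (suc k)))
    ≡⟨ sumℤ-concatMap (starTerm y (a ∷ v)) _ (allCubeFaces k) ⟩
  sumℤ (map (λ w → sumℤ (map (starTerm y (a ∷ v)) ((𝟎 ∷ w) ∷ (𝟏 ∷ w) ∷ (⋆ ∷ w) ∷ []))) (allCubeFaces k))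
    ≡⟨ sumℤ-cong (starTerm-children y a v) (allCubeFaces k) ⟩
  sumℤ (map (λ w → coordinateFactor y a * starTerm y v w) (allCubeFaces k))
    ≡⟨ sym (sumℤ-*ˡ (coordinateFactor y a) (starTerm y v) (allCubeFaces k)) ⟩
  coordinateFactor y a * sumℤ (map (starTerm y v) (allCubeFaces k))
    ≡⟨ cong (coordinateFactor y a *_) (sum-starTerm y k v) ⟩
  coordinateFactor y a * (y - + 1) ^ (k ∸ cdim v)
    ≡⟨ coordinateFactor-^ y a v ⟩
  (y - + 1) ^ (suc k ∸ cdim (a ∷ v)) ∎

hscTerm : ℕ → ℤ → ℕ → ℤ
hscTerm n x k = (+ 2 * x) ^ k * (+ 1 - x) ^ (n ∸ k)

carrierContribution : ∀ x d (v : CubeFace d) g → g ℕ.≤ cdim v →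
  sumℤ (map (λ F → if does (v ≤ᶜ? F) then (- + 1) ^ (d ∸ cdim F) * hscTerm (cdim F) x g else + 0)
            (allCubeFaces d))
    ≡ (- + 1) ^ d * ((- + 2) ^ g * (x ^ (d ∸ (cdim v ∸ g)) * (x - + 1) ^ (cdim v ∸ g)))
carrierContribution x d v g g≤s = begin
  _ ≡⟨ sumℤ-cong factorOut (allCubeFaces d) ⟩
  sumℤ (map (λ F → K * starTerm y v F) (allCubeFaces d))
    ≡⟨ sym (sumℤ-*ˡ K (starTerm y v) (allCubeFaces d)) ⟩
  K * sumℤ (map (starTerm y v) (allCubeFaces d))
    ≡⟨ cong (K *_) (sum-starTerm y d v) ⟩
  K * (y - + 1) ^ (d ∸ s)
    ≡⟨ monomial-identity x (d ∸ s) (s ∸ g) g ⟩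
  (- + 1) ^ ((d ∸ s) ℕ.+ g ℕ.+ (s ∸ g)) * ((- + 2) ^ g * (x ^ ((d ∸ s) ℕ.+ g) * (x - + 1) ^ (s ∸ g)))
    ≡⟨ cong₂ (λ n m → (- + 1) ^ n * ((- + 2) ^ g * (x ^ m * (x - + 1) ^ (s ∸ g))))
             (∸-partition g≤s s≤d) (sym (∸-partition-∸ g≤s s≤d)) ⟩
  (- + 1) ^ d * ((- + 2) ^ g * (x ^ (d ∸ (s ∸ g)) * (x - + 1) ^ (s ∸ g))) ∎
  where
  s = cdim v
  s≤d = cdim≤dim v
  y = + 1 - x
  K = (+ 2 * x) ^ g * y ^ (s ∸ g)
  factorOut : ∀ F →
    (if does (v ≤ᶜ? F) then (- + 1) ^ (d ∸ cdim F) * hscTerm (cdim F) x g else + 0) ≡ K * starTerm y v F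
  factorOut F with v ≤ᶜ? F
  ... | no _    = sym (ℤ.*-zeroʳ K)
  ... | yes v≤F = begin
    σF * ((+ 2 * x) ^ g * y ^ (cdim F ∸ g))
      ≡⟨ cong (λ n → σF * ((+ 2 * x) ^ g * y ^ n)) (∸-split g≤s (cdim-mono v≤F)) ⟩
    σF * ((+ 2 * x) ^ g * y ^ ((s ∸ g) ℕ.+ (cdim F ∸ s)))
      ≡⟨ cong (λ t → σF * ((+ 2 * x) ^ g * t)) (ℤ.^-distribˡ-+-* y (s ∸ g) (cdim F ∸ s)) ⟩
    σF * ((+ 2 * x) ^ g * (y ^ (s ∸ g) * y ^ (cdim F ∸ s)))
      ≡⟨ rearrange σF ((+ 2 * x) ^ g) (y ^ (s ∸ g)) (y ^ (cdim F ∸ s)) ⟩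
    K * (σF * y ^ (cdim F ∸ s)) ∎
    where
    σF = (- + 1) ^ (d ∸ cdim F)
    rearrange : ∀ a b c e → a * (b * (c * e)) ≡ b * c * (a * e)
    rearrange = solve-∀

signed-hscRestriction : ∀ {Ball d Γ} (S : CubicalSubdivision Ball d Γ) x F →
  (- + 1) ^ (d ∸ cdim F) * hscRestriction S F x
    ≡ sumℤ (map (λ G → if does (σ S G ≤ᶜ? F)
                         then (- + 1) ^ (d ∸ cdim F) * hscTerm (cdim F) x (dim Γ G) else + 0)
                (allFin (size Γ)))
signed-hscRestriction {d = d} {Γ} S x F = begin
  c * sumℤ (map (hscTerm (cdim F) x) (map (dim Γ) (filter carried Gs)))
    ≡⟨ cong (λ l → c * sumℤ l) (sym (List.map-∘ (filter carried Gs))) ⟩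
  c * sumℤ (map (λ G → hscTerm (cdim F) x (dim Γ G)) (filter carried Gs))
    ≡⟨ cong (c *_) (sumℤ-filter carried (λ G → hscTerm (cdim F) x (dim Γ G)) Gs) ⟩
  c * sumℤ (map (λ G → if does (carried G) then hscTerm (cdim F) x (dim Γ G) else + 0) Gs)
    ≡⟨ sumℤ-*ˡ c _ Gs ⟩
  sumℤ (map (λ G → c * (if does (carried G) then hscTerm (cdim F) x (dim Γ G) else + 0)) Gs)
    ≡⟨ sumℤ-cong (λ G → *-if-zero c (does (carried G)) _) Gs ⟩
  sumℤ (map (λ G → if does (carried G) then c * hscTerm (cdim F) x (dim Γ G) else + 0) Gs) ∎
  where
  c = (- + 1) ^ (d ∸ cdim F)
  Gs = allFin (size Γ)
  carried = λ G → σ S G ≤ᶜ? F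

proposition3p4 : (Ball : BallPredicate) (d : ℕ) (Γ : CubicalComplex)
    (S : CubicalSubdivision Ball d Γ) (x : ℤ) →
    localH S x ≡
      ((- + 1) ^ d) * sumℤ (map (λ G → ((- + 2) ^ dim Γ G) * ((x ^ (d ∸ excess S G)) * ((x - + 1) ^ excess S G))) (allFin (size Γ)))
proposition3p4 Ball d Γ S x = begin
  localH S x
    ≡⟨ sumℤ-cong (signed-hscRestriction S x) Fs ⟩
  sumℤ (map (λ F → sumℤ (map (contribution F) Gs)) Fs)
    ≡⟨ sumℤ-comm contribution Fs Gs ⟩
  sumℤ (map (λ G → sumℤ (map (λ F → contribution F G) Fs)) Gs)
    ≡⟨ sumℤ-cong (λ G → carrierContribution x d (σ S G) (dim Γ G) (dim-carrier S G)) Gs ⟩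
  sumℤ (map (λ G → (- + 1) ^ d * monomial G) Gs)
    ≡⟨ sym (sumℤ-*ˡ ((- + 1) ^ d) monomial Gs) ⟩
  (- + 1) ^ d * sumℤ (map monomial Gs) ∎
  where
  Fs = allCubeFaces d
  Gs = allFin (size Γ)
  contribution : CubeFace d → Fin (size Γ) → ℤ
  contribution F G = if does (σ S G ≤ᶜ? F)
                       then (- + 1) ^ (d ∸ cdim F) * hscTerm (cdim F) x (dim Γ G) else + 0
  monomial : Fin (size Γ) → ℤ
  monomial G = (- + 2) ^ dim Γ G * (x ^ (d ∸ excess S G) * (x - + 1) ^ excess S G)
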